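{- Let $k\ge0$, let $F,G\in[\mathsf{Set}^k,\mathsf{Set}]$, let $\alpha:F\to G$ be a natural transformation, and let $f_1:A_1\to B_1,\dots,f_k:A_k\to B_k$ be functions. Then $\langle\alpha\rangle^*(\langle f_1\rangle,\dots,\langle f_k\rangle)=\langle G\bar f\circ\alpha_{\bar A}\rangle=\langle\alpha_{\bar B}\circ F\bar f\rangle$.
   Context: $\mathsf{Rel}$ has objects $(A,B,R)$ with $R\subseteq A\times B$ (written $R:\mathsf{Rel}(A,B)$) and morphisms pairs of functions preserving relatedness. $[\mathsf{Set}^k,\mathsf{Set}]$ denotes the $\omega$-cocontinuous functors $\mathsf{Set}^k\to\mathsf{Set}$. For a function $g:A\to B$, $\langle g\rangle$ is its graph relation $(A,B,\{(x,gx)\mid x\in A\})$. Overbars denote tuples, e.g. $\bar f=(f_1,\dots,f_k)$, $\bar A=(A_1,\dots,A_k)$. Graph relation transformer of $\alpha$: for $R_i:\mathsf{Rel}(A_i,B_i)$, let $\iota_{R_i}:R_i\hookrightarrow A_i\times B_i$ be the inclusion, let $h_{\overline{A\times B}}=\langle F\bar\pi_1,\alpha_{\bar B}\circ F\bar\pi_2\rangle:F(\overline{A\times B})\to F\bar A\times G\bar B$, let $h_{\bar R}=h_{\overline{A\times B}}\circ F\bar\iota_R$, and let $\alpha^\wedge\bar R\subseteq F\bar A\times G\bar B$ be the image of $h_{\bar R}$. Then $\langle\alpha\rangle^*\bar R:=(F\bar A,G\bar B,\alpha^\wedge\bar R)$. -}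

module Defs where

open import Data.Nat using (ℕ; suc)
open import Data.Fin using (Fin)
open import Data.Unit using (⊤)
open import Data.Product using (Σ; ∃; _×_; _,_; proj₁; proj₂; <_,_>)
open import Relation.Binary.PropositionalEquality using (_≡_)

Obj : Set → Set₁
Obj I = I → Set

Hom : {I : Set} → Obj I → Obj I → Set
Hom {I} A B = (i : I) → A i → B i

-- Functors Set^k → Set (functor laws up to pointwise equality, since
-- function extensionality is not available).
record Functor (k : ℕ) : Set₁ where
  field
    F₀     : Obj (Fin k) → Set
    F₁     : {A B : Obj (Fin k)} → Hom A B → F₀ A → F₀ B
    F-cong : {A B : Obj (Fin k)} {f g : Hom A B} →
             ((i : Fin k) (a : A i) → f i a ≡ g i a) →
             (x : F₀ A) → F₁ f x ≡ F₁ g x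
    F-id   : {A : Obj (Fin k)} (x : F₀ A) → F₁ (λ i a → a) x ≡ x
    F-∘    : {A B C : Obj (Fin k)} (f : Hom A B) (g : Hom B C) (x : F₀ A) →
             F₁ (λ i a → g i (f i a)) x ≡ F₁ g (F₁ f x)
open Functor public

IsCocone : {I : Set} (D : ℕ → Obj I) (d : (n : ℕ) → Hom (D n) (D (suc n)))
           (C : Obj I) (c : (n : ℕ) → Hom (D n) C) → Set
IsCocone {I} D d C c = (n : ℕ) (i : I) (x : D n i) → c (suc n) i (d n i x) ≡ c n i x

IsColimit : {I : Set} (D : ℕ → Obj I) (d : (n : ℕ) → Hom (D n) (D (suc n)))
            (C : Obj I) (c : (n : ℕ) → Hom (D n) C) → Set₁
IsColimit {I} D d C c =
  (X : Obj I) (x : (n : ℕ) → Hom (D n) X) → IsCocone D d X x →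
  Σ (Hom C X) (λ u →
      ((n : ℕ) (i : I) (y : D n i) → u i (c n i y) ≡ x n i y)
    × ((v : Hom C X) → ((n : ℕ) (i : I) (y : D n i) → v i (c n i y) ≡ x n i y) →
       (i : I) (z : C i) → v i z ≡ u i z))

-- ω-cocontinuity: F preserves colimits of ω-chains (Set = Set^⊤).
OmegaCocontinuous : {k : ℕ} → Functor k → Set₁
OmegaCocontinuous {k} F =
  (D : ℕ → Obj (Fin k)) (d : (n : ℕ) → Hom (D n) (D (suc n)))
  (C : Obj (Fin k)) (c : (n : ℕ) → Hom (D n) C) →
  IsCocone D d C c → IsColimit D d C c →
  IsColimit {⊤} (λ n _ → F₀ F (D n)) (λ n _ → F₁ F (d n))
            (λ _ → F₀ F C) (λ n _ → F₁ F (c n))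

record NatTrans {k : ℕ} (F G : Functor k) : Set₁ where
  field
    η       : (A : Obj (Fin k)) → F₀ F A → F₀ G A
    natural : {A B : Obj (Fin k)} (f : Hom A B) (x : F₀ F A) →
              F₁ G f (η A x) ≡ η B (F₁ F f x)
open NatTrans public

Rel : Set → Set → Set₁
Rel A B = A → B → Set

_≐_ : {A B : Set} → Rel A B → Rel A B → Set
_≐_ {A} {B} R S = (a : A) (b : B) → (R a b → S a b) × (S a b → R a b)

graph : {A B : Set} → (A → B) → Rel A B
graph g a b = g a ≡ b

Carrier : {A B : Set} → Rel A B → Set
Carrier {A} {B} R = Σ (A × B) (λ p → R (proj₁ p) (proj₂ p))

ι : {A B : Set} (R : Rel A B) → Carrier R → A × B
ι R = proj₁

_×̇_ : {k : ℕ} → Obj (Fin k) → Obj (Fin k) → Obj (Fin k)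
(A ×̇ B) i = A i × B i

π₁ : {k : ℕ} {A B : Obj (Fin k)} → Hom (A ×̇ B) A
π₁ i = proj₁

π₂ : {k : ℕ} {A B : Obj (Fin k)} → Hom (A ×̇ B) B
π₂ i = proj₂

module _ {k : ℕ} {F G : Functor k} (α : NatTrans F G) where

  h× : (A B : Obj (Fin k)) → F₀ F (A ×̇ B) → F₀ F A × F₀ G B
  h× A B = < F₁ F π₁ , (λ x → η α B (F₁ F π₂ x)) >

  hR : (A B : Obj (Fin k)) (R : (i : Fin k) → Rel (A i) (B i)) →
       F₀ F (λ i → Carrier (R i)) → F₀ F A × F₀ G B
  hR A B R x = h× A B (F₁ F (λ i → ι (R i)) x)

  α∧ : (A B : Obj (Fin k)) (R : (i : Fin k) → Rel (A i) (B i)) →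
       Rel (F₀ F A) (F₀ G B)
  α∧ A B R a b = ∃ (λ x → hR A B R x ≡ (a , b))

  -- ⟨α⟩* R̄ = (F Ā, G B̄, α^∧ R̄); the carriers are fixed by the type.
  ⟨_⟩* : (A B : Obj (Fin k)) (R : (i : Fin k) → Rel (A i) (B i)) →
         Rel (F₀ F A) (F₀ G B)
  ⟨_⟩* = α∧

-- A graph ⟨ fᵢ ⟩, viewed as a set, is a copy of Aᵢ via a ↦ (a , fᵢ a). Hence
-- F applied to the tuple of graphs is a copy of F Ā, under which h_R̄ becomes
-- x ↦ (x , α_B̄ (F f̄ x)); its image is therefore the graph of α_B̄ ∘ F f̄,
-- which by graph-natural equals the graph of G f̄ ∘ α_Ā.
module Submission where

open import Defs
open import Data.Nat using (ℕ)
open import Data.Fin using (Fin)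
open import Data.Product using (_×_; _,_; proj₁; proj₂)
open import Function using (_∘_)
open import Relation.Binary.PropositionalEquality using (_≡_; refl; sym; trans; cong; cong₂; module ≡-Reasoning)
open ≡-Reasoning

≐-sym : {A B : Set} {R S : Rel A B} → R ≐ S → S ≐ R
≐-sym R≐S a b = proj₂ (R≐S a b) , proj₁ (R≐S a b)

≐-trans : {A B : Set} {R S T : Rel A B} → R ≐ S → S ≐ T → R ≐ T
≐-trans R≐S S≐T a b =
  proj₁ (S≐T a b) ∘ proj₁ (R≐S a b) , proj₂ (R≐S a b) ∘ proj₂ (S≐T a b)

graph-cong : {A B : Set} {g h : A → B} → (∀ a → g a ≡ h a) → graph g ≐ graph h
graph-cong g≗h a b = trans (sym (g≗h a)) , trans (g≗h a)

module _ {k : ℕ} {A B : Obj (Fin k)} (f : Hom A B) where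

  Graphs : Obj (Fin k)
  Graphs i = Carrier (graph (f i))

  graph-dom : Hom Graphs A
  graph-dom i = proj₁ ∘ proj₁

  graph-section : Hom A Graphs
  graph-section i a = (a , f i a) , refl

  module _ (F : Functor k) where

    F₁-dom∘section : (x : F₀ F A) → F₁ F graph-dom (F₁ F graph-section x) ≡ x
    F₁-dom∘section x = begin
      F₁ F graph-dom (F₁ F graph-section x)  ≡⟨ F-∘ F graph-section graph-dom x ⟨
      F₁ F (λ i a → a) x                     ≡⟨ F-id F x ⟩
      x                                      ∎

    F₁-π₁∘ι : (x : F₀ F Graphs) →
              F₁ F π₁ (F₁ F (λ i → ι (graph (f i))) x) ≡ F₁ F graph-dom x
    F₁-π₁∘ι x = sym (F-∘ F (λ i → ι (graph (f i))) π₁ x)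

    F₁-π₂∘ι : (x : F₀ F Graphs) →
              F₁ F π₂ (F₁ F (λ i → ι (graph (f i))) x) ≡ F₁ F f (F₁ F graph-dom x)
    F₁-π₂∘ι x = begin
      F₁ F π₂ (F₁ F (λ i → ι (graph (f i))) x)  ≡⟨ F-∘ F (λ i → ι (graph (f i))) π₂ x ⟨
      F₁ F (λ i c → proj₂ (proj₁ c)) x         ≡⟨ F-cong F (λ i c → sym (proj₂ c)) x ⟩
      F₁ F (λ i c → f i (proj₁ (proj₁ c))) x   ≡⟨ F-∘ F graph-dom f x ⟩
      F₁ F f (F₁ F graph-dom x)                ∎

  module _ {F G : Functor k} (α : NatTrans F G) where

    hR-graph : (x : F₀ F Graphs) →
               hR α A B (graph ∘ f) x
                 ≡ (F₁ F graph-dom x , η α B (F₁ F f (F₁ F graph-dom x)))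
    hR-graph x = cong₂ _,_ (F₁-π₁∘ι F x) (cong (η α B) (F₁-π₂∘ι F x))

    α∧-graph : α∧ α A B (graph ∘ f) ≐ graph (η α B ∘ F₁ F f)
    α∧-graph a b = into , onto
      where
      into : α∧ α A B (graph ∘ f) a b → η α B (F₁ F f a) ≡ b
      into (x , hx≡ab) with trans (sym (hR-graph x)) hx≡ab
      ... | refl = refl

      onto : η α B (F₁ F f a) ≡ b → α∧ α A B (graph ∘ f) a b
      onto refl = F₁ F graph-section a , (begin
        hR α A B (graph ∘ f) (F₁ F graph-section a)  ≡⟨ hR-graph (F₁ F graph-section a) ⟩
        (a′ , η α B (F₁ F f a′))                     ≡⟨ cong (λ y → y , η α B (F₁ F f y))
                                                              (F₁-dom∘section F a) ⟩
        (a , η α B (F₁ F f a))                       ∎)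
        where a′ = F₁ F graph-dom (F₁ F graph-section a)

lemma4p3 : (k : ℕ) (F G : Functor k) → OmegaCocontinuous F → OmegaCocontinuous G →
           (α : NatTrans F G) (A B : Obj (Fin k)) (f : Hom A B) →
           (⟨ α ⟩* A B (λ i → graph (f i)) ≐ graph (λ x → F₁ G f (η α A x)))
           × (graph (λ x → F₁ G f (η α A x)) ≐ graph (λ x → η α B (F₁ F f x)))
lemma4p3 k F G _ _ α A B f = ≐-trans (α∧-graph f α) (≐-sym graph-natural) , graph-natural
  where
  graph-natural : graph (λ x → F₁ G f (η α A x)) ≐ graph (λ x → η α B (F₁ F f x))
  graph-natural = graph-cong (natural α f)
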